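{- Let $F$ be a subgraph of the convex complete graph $K_n$ such that $K_n-F$ admits a triangulation. Then $sk_c(K_n-F)=\binom{n-2}{2}-|E(F)|$.
   Context: A convex complete graph $K_n$ is the complete graph on $n$ points in convex position in the plane, edges drawn as straight-line segments; a convex graph is a geometric graph whose vertices are in convex position. $K_n-F$ is obtained from $K_n$ by deleting the edges of $F$ (all vertices kept). A convex graph on $n$ vertices admits a triangulation if it contains all $n$ boundary edges (edges between vertices consecutive along the convex hull boundary) and $n-3$ pairwise non-crossing diagonals. The convex skewness $sk_c(G)$ of a convex graph $G$ is the minimum number of edges to be removed from $G$ so that the resulting convex graph has no two crossing edges (is a convex plane graph). -}

module Defs where

open import Data.Nat using (ℕ; zero; suc; _+_; _∸_; _<_; _<ᵇ_)
open import Data.Nat.Combinatorics using (_C_)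
open import Data.Fin using (Fin; toℕ)
open import Data.Bool using (Bool; true; false; _∧_; not; if_then_else_)
open import Data.List using (List; map; allFin)
open import Data.Nat.ListAction using (sum)
open import Data.Product using (_×_; Σ; ∃; _,_)
open import Data.Sum using (_⊎_)
open import Relation.Nullary using (¬_)
open import Relation.Binary.PropositionalEquality using (_≡_)

-- Vertices of a convex graph on n points are Fin n, labelled 0,1,…,n-1 in
-- cyclic order along the convex hull.  An edge set is a Boolean predicate on
-- ordered pairs; only pairs (i , j) with toℕ i < toℕ j are meaningful and the
-- edge {i,j} (i < j) is present iff S i j ≡ true.
EdgeSet : ℕ → Set
EdgeSet n = Fin n → Fin n → Bool

_<ᶠ_ : ∀ {n} → Fin n → Fin n → Set
i <ᶠ j = toℕ i < toℕ j

_∈ᴱ_ : ∀ {n} → Fin n × Fin n → EdgeSet n → Set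
(i , j) ∈ᴱ S = (i <ᶠ j) × (S i j ≡ true)

∣_∣ᴱ : ∀ {n} → EdgeSet n → ℕ
∣_∣ᴱ {n} S = sum (map (λ i → sum (map (λ j →
  if (toℕ i <ᵇ toℕ j) ∧ S i j then 1 else 0) (allFin n))) (allFin n))

K-minus : ∀ {n} → EdgeSet n → EdgeSet n
K-minus F i j = not (F i j)

_−ᴱ_ : ∀ {n} → EdgeSet n → EdgeSet n → EdgeSet n
(G −ᴱ R) i j = G i j ∧ not (R i j)

_⊆ᴱ_ : ∀ {n} → EdgeSet n → EdgeSet n → Set
_⊆ᴱ_ {n} R G = ∀ (i j : Fin n) → (i , j) ∈ᴱ R → (i , j) ∈ᴱ G

-- for points in convex position, edges {a,b} (a<b) and {c,d} (c<d) cross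
-- iff their endpoints strictly interleave along the boundary
Cross : ∀ {n} → Fin n → Fin n → Fin n → Fin n → Set
Cross a b c d = ((a <ᶠ c) × (c <ᶠ b) × (b <ᶠ d))
              ⊎ ((c <ᶠ a) × (a <ᶠ d) × (d <ᶠ b))

Plane : ∀ {n} → EdgeSet n → Set
Plane {n} S = ∀ (a b c d : Fin n) → (a , b) ∈ᴱ S → (c , d) ∈ᴱ S → ¬ Cross a b c d

Boundary : ∀ {n} → Fin n → Fin n → Set
Boundary {n} i j = (suc (toℕ i) ≡ toℕ j) ⊎ ((toℕ i ≡ 0) × (suc (toℕ j) ≡ n))

AdmitsTriangulation : ∀ {n} → EdgeSet n → Set
AdmitsTriangulation {n} G =
  (∀ (i j : Fin n) → i <ᶠ j → Boundary i j → (i , j) ∈ᴱ G)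
  × (Σ (EdgeSet n) λ D →
       D ⊆ᴱ G
     × (∀ (i j : Fin n) → (i , j) ∈ᴱ D → ¬ Boundary i j)
     × Plane D
     × (∣ D ∣ᴱ ≡ n ∸ 3))

IsConvexSkewness : ∀ {n} → EdgeSet n → ℕ → Set
IsConvexSkewness {n} G k =
  (Σ (EdgeSet n) λ R → R ⊆ᴱ G × Plane (G −ᴱ R) × (∣ R ∣ᴱ ≡ k))
  × (∀ (R : EdgeSet n) → R ⊆ᴱ G → Plane (G −ᴱ R) → k Data.Nat.≤ ∣ R ∣ᴱ)

module Submission where

-- A convex plane graph on n ≥ 2 vertices has at most 2n − 3 edges
-- (plane-bound).  We count the edges spanned by an interval [a , b] of vertex
-- labels and induct on b − a: if a has no neighbour strictly inside (a , b),
-- delete a; otherwise split at the last such neighbour c, since no edge can jump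
-- over c without crossing ac.  Conversely the n boundary edges and the n − 3
-- diagonals of the triangulation form a plane subgraph of G = K_n − F with
-- exactly 2n − 3 edges (triangulation-skeleton).  Hence deleting the rest of G
-- is optimal, and sk_c(G) = |G| − (2n − 3) (skewness-of-maximal-plane).  Finally
-- |G| = n C 2 − |F| and n C 2 − (2n − 3) = (n−2) C 2.

open import Defs
open import Level using (0ℓ)
open import Data.Nat using (ℕ; zero; suc; pred; _+_; _*_; _∸_; _≤_; _<_; _<ᵇ_; _≡ᵇ_; z≤n; s≤s; s≤s⁻¹)
open import Data.Nat.Tactic.RingSolver using (solve-∀)
open import Data.Nat.Properties
open import Data.Nat.Combinatorics using (_C_; nC1≡n; nCk+nC[k+1]≡[n+1]C[k+1])
open import Data.Fin using (Fin; zero; suc; toℕ; fromℕ; fromℕ<)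
open import Data.Fin.Properties using (toℕ<n; toℕ-fromℕ; toℕ-fromℕ<; any?)
open import Data.Bool using (Bool; true; false; _∧_; if_then_else_)
import Data.Bool.Properties as Bool
open import Data.List using (map; allFin; tabulate)
open import Data.List.Properties using (map-tabulate)
import Data.Nat.ListAction as List
open import Data.Product using (Σ; _×_; _,_; ∃; proj₁; proj₂)
open import Data.Sum using (_⊎_; inj₁; inj₂; [_,_])
open import Function using (_∘_)
open import Relation.Binary.Core using (Rel)
open import Relation.Binary.Definitions using (Decidable)
open import Relation.Binary.PropositionalEquality
  using (_≡_; refl; sym; trans; cong; cong₂; subst; subst₂; module ≡-Reasoning)
open import Data.Empty using (⊥)
open import Relation.Nullary using (Dec; yes; no; does; ¬_; contradiction)
open import Relation.Nullary.Decidable using (_×-dec_; _⊎-dec_; dec-true)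
open import Algebra.Properties.CommutativeMonoid.Sum +-0-commutativeMonoid
  using (sum-syntax; ∑-distrib-+; sum-cong-≗; sum-replicate-zero)

ind : Bool → ℕ
ind b = if b then 1 else 0

∑-mono-≤ : ∀ {n} {f g : Fin n → ℕ} → (∀ i → f i ≤ g i) → ∑[ i < n ] f i ≤ ∑[ i < n ] g i
∑-mono-≤ {zero}  _   = z≤n
∑-mono-≤ {suc n} f≤g = +-mono-≤ (f≤g zero) (∑-mono-≤ (f≤g ∘ suc))

∑-term : ∀ {n} (f : Fin n → ℕ) (i : Fin n) → f i ≤ ∑[ k < n ] f k
∑-term f zero    = m≤m+n (f zero) _
∑-term f (suc i) = ≤-trans (∑-term (f ∘ suc) i) (m≤n+m _ (f zero))

∑-prefix : ∀ {n} (M : ℕ) (f : Fin n → ℕ) → M ≤ n → (∀ i → toℕ i < M → 1 ≤ f i) →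
           M ≤ ∑[ i < n ] f i
∑-prefix zero    f _         _   = z≤n
∑-prefix (suc M) f (s≤s M≤n) pos =
  +-mono-≤ (pos zero (s≤s z≤n)) (∑-prefix M (f ∘ suc) M≤n (λ i i<M → pos (suc i) (s≤s i<M)))

∑-ones : ∀ n → ∑[ i < n ] 1 ≡ n
∑-ones zero    = refl
∑-ones (suc n) = cong suc (∑-ones n)

∑-at-most-once : ∀ {n} (a : ℕ) → ∑[ i < n ] ind (toℕ i ≡ᵇ a) ≤ 1
∑-at-most-once {zero}  _       = z≤n
∑-at-most-once {suc n} zero    = ≤-reflexive (cong suc (sum-replicate-zero n))
∑-at-most-once {suc n} (suc a) = ∑-at-most-once {n} a

list-sum≡∑ : ∀ {n} (f : Fin n → ℕ) → List.sum (map f (allFin n)) ≡ ∑[ i < n ] f i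
list-sum≡∑ {n} f = trans (cong List.sum (map-tabulate (λ i → i) f)) (tabulate-sum f)
  where
  tabulate-sum : ∀ {m} (g : Fin m → ℕ) → List.sum (tabulate g) ≡ ∑[ i < m ] g i
  tabulate-sum {zero}  g = refl
  tabulate-sum {suc m} g = cong (g zero +_) (tabulate-sum (g ∘ suc))

count : ∀ {n} {P : Rel (Fin n) 0ℓ} → Decidable P → ℕ
count {n} P? = ∑[ i < n ] ∑[ j < n ] ind (does (P? i j))

1≤ind : ∀ {A : Set} (a? : Dec A) → A → 1 ≤ ind (does a?)
1≤ind (yes _) _ = s≤s z≤n
1≤ind (no ¬a) a = contradiction a ¬a

ind-mono : ∀ {A B : Set} (a? : Dec A) (b? : Dec B) → (A → B) → ind (does a?) ≤ ind (does b?)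
ind-mono (no _)  _  _   = z≤n
ind-mono (yes a) b? A→B = 1≤ind b? (A→B a)

ind-cover : ∀ {A B C : Set} (a? : Dec A) (b? : Dec B) (c? : Dec C) → (A → B ⊎ C) →
            ind (does a?) ≤ ind (does b?) + ind (does c?)
ind-cover (no _)  _       _       _     = z≤n
ind-cover (yes _) (yes _) _       _     = s≤s z≤n
ind-cover (yes _) (no _)  (yes _) _     = s≤s z≤n
ind-cover (yes a) (no ¬b) (no ¬c) cover = contradiction (cover a) [ ¬b , ¬c ]

ind-disjoint : ∀ {A B C : Set} (a? : Dec A) (b? : Dec B) (c? : Dec C) →
               (A → C) → (B → C) → (A → B → ⊥) → ind (does a?) + ind (does b?) ≤ ind (does c?)
ind-disjoint (no _)  (no _)  _  _   _   _        = z≤n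
ind-disjoint (yes a) (no _)  c? A→C _   _        = 1≤ind c? (A→C a)
ind-disjoint (no _)  (yes b) c? _   B→C _        = 1≤ind c? (B→C b)
ind-disjoint (yes a) (yes b) _  _   _   disjoint = contradiction b (disjoint a)

count-+ : ∀ {n} {P Q : Rel (Fin n) 0ℓ} (P? : Decidable P) (Q? : Decidable Q) →
          count P? + count Q? ≡ ∑[ i < n ] ∑[ j < n ] (ind (does (P? i j)) + ind (does (Q? i j)))
count-+ {n} P? Q? =
  sym (trans (sum-cong-≗ (λ i → ∑-distrib-+ (p i) (q i))) (∑-distrib-+ (∑ ∘ p) (∑ ∘ q)))
  where
  p q : Fin n → Fin n → ℕ
  p i j = ind (does (P? i j))
  q i j = ind (does (Q? i j))
  ∑ : (Fin n → ℕ) → ℕ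
  ∑ f = ∑[ j < n ] f j

∑∑-mono-≤ : ∀ {n} {f g : Fin n → Fin n → ℕ} → (∀ i j → f i j ≤ g i j) →
            ∑[ i < n ] ∑[ j < n ] f i j ≤ ∑[ i < n ] ∑[ j < n ] g i j
∑∑-mono-≤ {n} f≤g = ∑-mono-≤ {n} (λ i → ∑-mono-≤ {n} (f≤g i))

count-mono : ∀ {n} {P Q : Rel (Fin n) 0ℓ} (P? : Decidable P) (Q? : Decidable Q) →
             (∀ i j → P i j → Q i j) → count P? ≤ count Q?
count-mono {n} P? Q? P⇒Q = ∑∑-mono-≤ {n} (λ i j → ind-mono (P? i j) (Q? i j) (P⇒Q i j))

count-cover : ∀ {n} {P Q R : Rel (Fin n) 0ℓ} (P? : Decidable P) (Q? : Decidable Q) (R? : Decidable R) →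
              (∀ i j → P i j → Q i j ⊎ R i j) → count P? ≤ count Q? + count R?
count-cover {n} P? Q? R? cover =
  ≤-trans (∑∑-mono-≤ {n} (λ i j → ind-cover (P? i j) (Q? i j) (R? i j) (cover i j)))
          (≤-reflexive (sym (count-+ Q? R?)))

count-disjoint : ∀ {n} {P Q R : Rel (Fin n) 0ℓ} (P? : Decidable P) (Q? : Decidable Q) (R? : Decidable R) →
                 (∀ i j → P i j → R i j) → (∀ i j → Q i j → R i j) →
                 (∀ i j → P i j → Q i j → ⊥) → count P? + count Q? ≤ count R?
count-disjoint {n} P? Q? R? P⇒R Q⇒R disjoint = ≤-trans (≤-reflexive (count-+ P? Q?))
  (∑∑-mono-≤ {n} (λ i j → ind-disjoint (P? i j) (Q? i j) (R? i j) (P⇒R i j) (Q⇒R i j) (disjoint i j)))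

count-partition : ∀ {n} {P Q R : Rel (Fin n) 0ℓ} (P? : Decidable P) (Q? : Decidable Q) (R? : Decidable R) →
                  (∀ i j → P i j → Q i j ⊎ R i j) → (∀ i j → Q i j → P i j) →
                  (∀ i j → R i j → P i j) → (∀ i j → Q i j → R i j → ⊥) →
                  count P? ≡ count Q? + count R?
count-partition P? Q? R? cover Q⇒P R⇒P disjoint =
  ≤-antisym (count-cover P? Q? R? cover) (count-disjoint Q? R? P? Q⇒P R⇒P disjoint)

count-rows : ∀ {n} {P : Rel (Fin n) 0ℓ} (P? : Decidable P) (M : ℕ) → M ≤ n →
             (∀ i → toℕ i < M → ∃ λ j → P i j) → M ≤ count P?
count-rows {n} P? M M≤n witness = ∑-prefix M _ M≤n row-positive
  where
  row-positive : ∀ i → toℕ i < M → 1 ≤ ∑[ j < n ] ind (does (P? i j))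
  row-positive i i<M with witness i i<M
  ... | j , p = ≤-trans (1≤ind (P? i j) p) (∑-term (λ k → ind (does (P? i k))) j)

count-single : ∀ {n} (a b : ℕ) → count {n} (λ i j → (toℕ i ≟ a) ×-dec (toℕ j ≟ b)) ≤ 1
count-single {n} a b = ≤-trans (∑-mono-≤ {n} row≤) (∑-at-most-once {n} a)
  where
  row≤ : ∀ i → ∑[ j < n ] ind ((toℕ i ≡ᵇ a) ∧ (toℕ j ≡ᵇ b)) ≤ ind (toℕ i ≡ᵇ a)
  row≤ i with toℕ i ≡ᵇ a
  ... | true  = ∑-at-most-once {n} b
  ... | false = ≤-reflexive (sum-replicate-zero n)

C2-suc : ∀ m → suc m C 2 ≡ m + m C 2
C2-suc m = trans (sym (nCk+nC[k+1]≡[n+1]C[k+1] m 1)) (cong (_+ m C 2) (nC1≡n m))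

count-< : ∀ n → count {n} (λ i j → toℕ i <? toℕ j) ≡ n C 2
count-< zero    = refl
count-< (suc n) = begin
  ∑[ j < n ] 1 + count {n} (λ i j → toℕ i <? toℕ j) ≡⟨ cong₂ _+_ (∑-ones n) (count-< n) ⟩
  n + n C 2                                        ≡⟨ sym (C2-suc n) ⟩
  suc n C 2                                        ∎
  where open ≡-Reasoning

∈ᴱ? : ∀ {n} (S : EdgeSet n) → Decidable (λ i j → (i , j) ∈ᴱ S)
∈ᴱ? S i j = (toℕ i <? toℕ j) ×-dec (S i j Bool.≟ true)

∣∣ᴱ≡count : ∀ {n} (S : EdgeSet n) → ∣ S ∣ᴱ ≡ count (∈ᴱ? S)
∣∣ᴱ≡count {n} S = trans (list-sum≡∑ row) (sum-cong-≗ (λ i →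
  trans (list-sum≡∑ (entry i))
        (sum-cong-≗ (λ j → cong (λ b → ind ((toℕ i <ᵇ toℕ j) ∧ b)) (does-≟-true (S i j))))))
  where
  entry : Fin n → Fin n → ℕ
  entry i j = ind ((toℕ i <ᵇ toℕ j) ∧ S i j)
  row : Fin n → ℕ
  row i = List.sum (map (entry i) (allFin n))
  does-≟-true : ∀ b → b ≡ does (b Bool.≟ true)
  does-≟-true true  = refl
  does-≟-true false = refl

Cross-sym : ∀ {n} {a b c d : Fin n} → Cross a b c d → Cross c d a b
Cross-sym (inj₁ interleave) = inj₂ interleave
Cross-sym (inj₂ interleave) = inj₁ interleave

boundary-uncrossed : ∀ {n} (a b c d : Fin n) → Boundary a b → ¬ Cross a b c d
boundary-uncrossed a b c d (inj₁ a+1≡b) (inj₁ (a<c , c<b , _)) =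
  <⇒≱ a<c (s≤s⁻¹ (subst (toℕ c <_) (sym a+1≡b) c<b))
boundary-uncrossed a b c d (inj₁ a+1≡b) (inj₂ (_ , a<d , d<b)) =
  <⇒≱ a<d (s≤s⁻¹ (subst (toℕ d <_) (sym a+1≡b) d<b))
boundary-uncrossed a b c d (inj₂ (_ , b+1≡n)) (inj₁ (_ , _ , b<d)) =
  <⇒≱ b<d (s≤s⁻¹ (subst (toℕ d <_) (sym b+1≡n) (toℕ<n d)))
boundary-uncrossed a b c d (inj₂ (a≡0 , _)) (inj₂ (c<a , _ , _)) =
  n≮0 (subst (toℕ c <_) a≡0 c<a)

∸-peel : ∀ {a b} → a < b → b ∸ a ≡ suc (b ∸ suc a)
∸-peel {zero}  {suc b} _         = refl
∸-peel {suc a} {suc b} (s≤s a<b) = ∸-peel a<b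

∸-split : ∀ {a b c} → a ≤ c → c ≤ b → (c ∸ a) + (b ∸ c) ≡ b ∸ a
∸-split z≤n       c≤b       = m+[n∸m]≡n c≤b
∸-split (s≤s a≤c) (s≤s c≤b) = ∸-split a≤c c≤b

data Last (P : ℕ → Set) (b : ℕ) : Set where
  none  : (∀ k → k < b → ¬ P k) → Last P b
  found : ∀ c → c < b → P c → (∀ k → c < k → k < b → ¬ P k) → Last P b

last : ∀ {P : ℕ → Set} → (∀ k → Dec (P k)) → ∀ b → Last P b
last P? zero = none (λ _ ())
last P? (suc b) with P? b
... | yes p = found b (n<1+n b) p (λ k b<k k<1+b _ → <⇒≱ b<k (s≤s⁻¹ k<1+b))
... | no ¬p with last P? b
...   | none ¬P = none (λ k k<1+b → [ ¬P k , (λ { refl → ¬p }) ] (m<1+n⇒m<n∨m≡n k<1+b))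
...   | found c c<b p max =
  found c (m<n⇒m<1+n c<b) p (λ k c<k k<1+b → [ max k c<k , (λ { refl → ¬p }) ] (m<1+n⇒m<n∨m≡n k<1+b))

module IntervalBound {n : ℕ} (S : EdgeSet n) (plane : Plane S) where

  Inside : ℕ → ℕ → Rel (Fin n) 0ℓ
  Inside a b i j = a ≤ toℕ i × toℕ j ≤ b × (i , j) ∈ᴱ S

  inside? : ∀ a b → Decidable (Inside a b)
  inside? a b i j = (a ≤? toℕ i) ×-dec (toℕ j ≤? b) ×-dec ∈ᴱ? S i j

  E : ℕ → ℕ → ℕ
  E a b = count (inside? a b)

  Pair : ℕ → ℕ → Rel (Fin n) 0ℓ
  Pair a b i j = toℕ i ≡ a × toℕ j ≡ b

  pair? : ∀ a b → Decidable (Pair a b)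
  pair? a b i j = (toℕ i ≟ a) ×-dec (toℕ j ≟ b)

  Joined : ℕ → ℕ → Set
  Joined a k = ∃ λ i → ∃ λ j → Pair a k i j × (i , j) ∈ᴱ S

  joined? : ∀ a k → Dec (Joined a k)
  joined? a k = any? (λ i → any? (λ j → pair? a k i j ×-dec ∈ᴱ? S i j))

  E-consecutive : ∀ a → E a (suc a) ≤ 1
  E-consecutive a = ≤-trans (count-mono (inside? a (suc a)) (pair? a (suc a)) is-pair)
                            (count-single {n} a (suc a))
    where
    is-pair : ∀ i j → Inside a (suc a) i j → Pair a (suc a) i j
    is-pair i j (a≤i , j≤a+1 , i<j , _) =
      ≤-antisym (s≤s⁻¹ (<-≤-trans i<j j≤a+1)) a≤i , ≤-antisym j≤a+1 (<-≤-trans (s≤s a≤i) i<j)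

  E-peel : ∀ a b → (∀ k → a < k → k < b → ¬ Joined a k) → E a b ≤ E (suc a) b + 1
  E-peel a b isolated =
    ≤-trans (count-cover (inside? a b) (inside? (suc a) b) (pair? a b) classify)
            (+-monoʳ-≤ (E (suc a) b) (count-single {n} a b))
    where
    classify : ∀ i j → Inside a b i j → Inside (suc a) b i j ⊎ Pair a b i j
    classify i j (a≤i , j≤b , ij@(i<j , _)) with m≤n⇒m<n∨m≡n a≤i | m≤n⇒m<n∨m≡n j≤b
    ... | inj₁ a<i | _        = inj₁ (a<i , j≤b , ij)
    ... | inj₂ a≡i | inj₂ j≡b = inj₂ (sym a≡i , j≡b)
    ... | inj₂ a≡i | inj₁ j<b =
      contradiction (i , j , (sym a≡i , refl) , ij) (isolated (toℕ j) (subst (_< toℕ j) (sym a≡i) i<j) j<b)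

  -- if c is the last neighbour of a inside (a , b), every edge of [a , b] other than ab
  -- lies in [a , c] or in [c , b]: an edge from strictly between a and c to beyond c
  -- would cross ac
  E-split : ∀ a b c → Joined a c → (∀ k → c < k → k < b → ¬ Joined a k) →
            E a b ≤ (E a c + E c b) + 1
  E-split a b c (u , v , (u≡a , v≡c) , uv) last-neighbour =
    ≤-trans (count-cover (inside? a b) either? (pair? a b) classify)
            (+-mono-≤ (count-cover either? (inside? a c) (inside? c b) (λ _ _ side → side))
                      (count-single {n} a b))
    where
    either? : Decidable (λ i j → Inside a c i j ⊎ Inside c b i j)
    either? i j = inside? a c i j ⊎-dec inside? c b i j

    classify : ∀ i j → Inside a b i j → (Inside a c i j ⊎ Inside c b i j) ⊎ Pair a b i j
    classify i j (a≤i , j≤b , ij@(i<j , _)) with toℕ j ≤? c | c ≤? toℕ i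
    ... | yes j≤c | _       = inj₁ (inj₁ (a≤i , j≤c , ij))
    ... | no _    | yes c≤i = inj₁ (inj₂ (c≤i , j≤b , ij))
    ... | no j≰c  | no i≱c with m≤n⇒m<n∨m≡n a≤i | m≤n⇒m<n∨m≡n j≤b
    ...   | inj₁ a<i | _        = contradiction
      (inj₁ (subst (_< toℕ i) (sym u≡a) a<i , subst (toℕ i <_) (sym v≡c) (≰⇒> i≱c) ,
             subst (_< toℕ j) (sym v≡c) (≰⇒> j≰c)))
      (plane u v i j uv ij)
    ...   | inj₂ a≡i | inj₂ j≡b = inj₂ (sym a≡i , j≡b)
    ...   | inj₂ a≡i | inj₁ j<b =
      contradiction (i , j , (sym a≡i , refl) , ij) (last-neighbour (toℕ j) (≰⇒> j≰c) j<b)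

  interval-bound : ∀ m a b → a < b → b ∸ a ≤ m → E a b + 1 ≤ 2 * (b ∸ a)
  interval-bound zero    a b a<b len≤0 = contradiction (n≤0⇒n≡0 len≤0) (m>n⇒m∸n≢0 a<b)
  interval-bound (suc m) a b a<b len≤m+1 with m≤n⇒m<n∨m≡n a<b
  ... | inj₂ refl = begin
    E a (suc a) + 1   ≤⟨ +-monoˡ-≤ 1 (E-consecutive a) ⟩
    2 * 1             ≡⟨ cong (2 *_) (sym (trans (∸-peel (n<1+n a)) (cong suc (n∸n≡0 a)))) ⟩
    2 * (suc a ∸ a)   ∎
    where open ≤-Reasoning
  ... | inj₁ a+1<b with last (λ k → (a <? k) ×-dec joined? a k) b
  ...   | none no-neighbour = begin
    E a b + 1                  ≤⟨ +-monoˡ-≤ 1 (E-peel a b isolated) ⟩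
    (E (suc a) b + 1) + 1      ≤⟨ +-monoˡ-≤ 1 (interval-bound m (suc a) b a+1<b shorter) ⟩
    2 * (b ∸ suc a) + 1        ≤⟨ n≤1+n _ ⟩
    suc (2 * (b ∸ suc a) + 1)  ≡⟨ double-suc (b ∸ suc a) ⟩
    2 * suc (b ∸ suc a)        ≡⟨ cong (2 *_) (sym (∸-peel a<b)) ⟩
    2 * (b ∸ a)                ∎
    where
    open ≤-Reasoning
    isolated : ∀ k → a < k → k < b → ¬ Joined a k
    isolated k a<k k<b joined = no-neighbour k k<b (a<k , joined)
    shorter : b ∸ suc a ≤ m
    shorter = s≤s⁻¹ (subst (_≤ suc m) (∸-peel a<b) len≤m+1)
    double-suc : ∀ x → suc (2 * x + 1) ≡ 2 * suc x
    double-suc = solve-∀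
  ...   | found c c<b (a<c , joined) max = begin
    E a b + 1                          ≤⟨ +-monoˡ-≤ 1 (E-split a b c joined last-neighbour) ⟩
    (E a c + E c b) + 1 + 1            ≡⟨ regroup (E a c) (E c b) ⟩
    (E a c + 1) + (E c b + 1)          ≤⟨ +-mono-≤ (interval-bound m a c a<c left-shorter)
                                                   (interval-bound m c b c<b right-shorter) ⟩
    2 * (c ∸ a) + 2 * (b ∸ c)          ≡⟨ sym (*-distribˡ-+ 2 (c ∸ a) (b ∸ c)) ⟩
    2 * ((c ∸ a) + (b ∸ c))            ≡⟨ cong (2 *_) (∸-split (<⇒≤ a<c) (<⇒≤ c<b)) ⟩
    2 * (b ∸ a)                        ∎
    where
    open ≤-Reasoning
    last-neighbour : ∀ k → c < k → k < b → ¬ Joined a k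
    last-neighbour k c<k k<b joined-k = max k c<k k<b (<-trans a<c c<k , joined-k)
    left-shorter : c ∸ a ≤ m
    left-shorter = s≤s⁻¹ (<-≤-trans (∸-monoˡ-< c<b (<⇒≤ a<c)) len≤m+1)
    right-shorter : b ∸ c ≤ m
    right-shorter = s≤s⁻¹ (<-≤-trans (∸-monoʳ-< a<c (<⇒≤ c<b)) len≤m+1)
    regroup : ∀ x y → x + y + 1 + 1 ≡ (x + 1) + (y + 1)
    regroup = solve-∀

plane-bound : ∀ {n} (S : EdgeSet n) → Plane S → 2 ≤ n → ∣ S ∣ᴱ + 1 ≤ 2 * pred n
plane-bound {n} S plane 2≤n = begin
  ∣ S ∣ᴱ + 1         ≡⟨ cong (_+ 1) (∣∣ᴱ≡count S) ⟩
  count (∈ᴱ? S) + 1  ≤⟨ +-monoˡ-≤ 1 (count-mono (∈ᴱ? S) (inside? 0 (pred n)) spanned) ⟩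
  E 0 (pred n) + 1   ≤⟨ interval-bound (pred n) 0 (pred n) (<⇒≤pred 2≤n) ≤-refl ⟩
  2 * pred n         ∎
  where
  open IntervalBound S plane
  open ≤-Reasoning
  spanned : ∀ i j → (i , j) ∈ᴱ S → Inside 0 (pred n) i j
  spanned i j ij = z≤n , <⇒≤pred (toℕ<n j) , ij

boundary? : ∀ {n} → Decidable (Boundary {n})
boundary? {n} i j = (suc (toℕ i) ≟ toℕ j) ⊎-dec ((toℕ i ≟ 0) ×-dec (suc (toℕ j) ≟ n))

boundary-edge? : ∀ {n} → Decidable (λ (i j : Fin n) → i <ᶠ j × Boundary i j)
boundary-edge? i j = (toℕ i <? toℕ j) ×-dec boundary? i j

boundary-count : ∀ k → 3 + k ≤ count (boundary-edge? {3 + k})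
boundary-count k = begin
  3 + k                          ≡⟨ +-comm 1 (2 + k) ⟩
  (2 + k) + 1                    ≤⟨ +-mono-≤ (count-rows succ? (2 + k) (n≤1+n _) next)
                                             (count-rows closing? 1 (s≤s z≤n) last-vertex) ⟩
  count succ? + count closing?   ≤⟨ count-disjoint succ? closing? (boundary-edge? {N})
                                                    succ-boundary closing-boundary distinct ⟩
  count (boundary-edge? {N})     ∎
  where
  open ≤-Reasoning
  N = 3 + k
  Succ Closing : Rel (Fin N) 0ℓ
  Succ i j = suc (toℕ i) ≡ toℕ j
  Closing i j = toℕ i ≡ 0 × suc (toℕ j) ≡ N
  succ? : Decidable Succ
  succ? i j = suc (toℕ i) ≟ toℕ j
  closing? : Decidable Closing
  closing? i j = (toℕ i ≟ 0) ×-dec (suc (toℕ j) ≟ N)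
  next : ∀ i → toℕ i < 2 + k → ∃ λ j → Succ i j
  next i i<2+k = fromℕ< (s≤s i<2+k) , sym (toℕ-fromℕ< (s≤s i<2+k))
  last-vertex : ∀ i → toℕ i < 1 → ∃ λ j → Closing i j
  last-vertex i i<1 = fromℕ (2 + k) , n≤0⇒n≡0 (s≤s⁻¹ i<1) , cong suc (toℕ-fromℕ (2 + k))
  succ-boundary : ∀ i j → Succ i j → i <ᶠ j × Boundary i j
  succ-boundary i j i+1≡j = ≤-reflexive i+1≡j , inj₁ i+1≡j
  closing-boundary : ∀ i j → Closing i j → i <ᶠ j × Boundary i j
  closing-boundary i j (i≡0 , j+1≡N) =
    subst₂ _<_ (sym i≡0) (suc-injective (sym j+1≡N)) (s≤s z≤n) , inj₂ (i≡0 , j+1≡N)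
  distinct : ∀ i j → Succ i j → Closing i j → ⊥
  distinct i j i+1≡j (i≡0 , j+1≡N) with trans (sym (cong suc (trans (sym i+1≡j) (cong suc i≡0)))) j+1≡N
  ... | ()

does-true : ∀ {A : Set} (a? : Dec A) → does a? ≡ true → A
does-true (yes a) _ = a

∧-≡-true : ∀ {x y} → x ∧ y ≡ true → x ≡ true × y ≡ true
∧-≡-true {true} {true} _ = refl , refl

removal-size : ∀ {n} (G R : EdgeSet n) → R ⊆ᴱ G → ∣ G −ᴱ R ∣ᴱ + ∣ R ∣ᴱ ≡ ∣ G ∣ᴱ
removal-size G R R⊆G = begin
  ∣ G −ᴱ R ∣ᴱ + ∣ R ∣ᴱ                 ≡⟨ cong₂ _+_ (∣∣ᴱ≡count (G −ᴱ R)) (∣∣ᴱ≡count R) ⟩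
  count (∈ᴱ? (G −ᴱ R)) + count (∈ᴱ? R) ≡⟨ sym (count-partition (∈ᴱ? G) (∈ᴱ? (G −ᴱ R)) (∈ᴱ? R)
                                              kept-or-removed kept⊆G R⊆G kept∩removed) ⟩
  count (∈ᴱ? G)                        ≡⟨ sym (∣∣ᴱ≡count G) ⟩
  ∣ G ∣ᴱ                               ∎
  where
  open ≡-Reasoning
  kept-or-removed : ∀ i j → (i , j) ∈ᴱ G → (i , j) ∈ᴱ (G −ᴱ R) ⊎ (i , j) ∈ᴱ R
  kept-or-removed i j (i<j , g) with R i j
  ... | true  = inj₂ (i<j , refl)
  ... | false = inj₁ (i<j , trans (Bool.∧-identityʳ (G i j)) g)
  kept⊆G : ∀ i j → (i , j) ∈ᴱ (G −ᴱ R) → (i , j) ∈ᴱ G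
  kept⊆G i j (i<j , kept) = i<j , proj₁ (∧-≡-true kept)
  kept∩removed : ∀ i j → (i , j) ∈ᴱ (G −ᴱ R) → (i , j) ∈ᴱ R → ⊥
  kept∩removed i j (_ , kept) (_ , r) with R i j | proj₂ (∧-≡-true {G i j} kept)
  ... | true | ()

complete : ∀ n → EdgeSet n
complete n _ _ = true

complete-size : ∀ n → ∣ complete n ∣ᴱ ≡ n C 2
complete-size n = begin
  ∣ complete n ∣ᴱ                       ≡⟨ ∣∣ᴱ≡count (complete n) ⟩
  count (∈ᴱ? (complete n))              ≡⟨ ≤-antisym (count-mono (∈ᴱ? (complete n)) lt? (λ _ _ → proj₁))
                                                     (count-mono lt? (∈ᴱ? (complete n)) (λ _ _ i<j → i<j , refl)) ⟩
  count lt?                             ≡⟨ count-< n ⟩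
  n C 2                                 ∎
  where
  open ≡-Reasoning
  lt? : Decidable (_<ᶠ_ {n})
  lt? i j = toℕ i <? toℕ j

complement-size : ∀ {n} (F : EdgeSet n) → ∣ K-minus F ∣ᴱ + ∣ F ∣ᴱ ≡ n C 2
complement-size {n} F =
  trans (removal-size (complete n) F (λ i j (i<j , _) → i<j , refl)) (complete-size n)

triangulation-skeleton : ∀ k (G : EdgeSet (3 + k)) → AdmitsTriangulation G →
  Σ (EdgeSet (3 + k)) λ R → R ⊆ᴱ G × Plane (G −ᴱ R) × 2 * (2 + k) ≤ ∣ G −ᴱ R ∣ᴱ + 1
triangulation-skeleton k G (boundary⊆G , D , D⊆G , diagonal , D-plane , ∣D∣≡k) =
  G −ᴱ skeleton , removed⊆G , plane , large
  where
  Skeleton : Rel (Fin (3 + k)) 0ℓ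
  Skeleton i j = Boundary i j ⊎ D i j ≡ true
  skeleton? : Decidable Skeleton
  skeleton? i j = boundary? i j ⊎-dec (D i j Bool.≟ true)
  skeleton : EdgeSet (3 + k)
  skeleton i j = does (skeleton? i j)

  -- the skeleton edges of G
  H : EdgeSet (3 + k)
  H = G −ᴱ (G −ᴱ skeleton)

  removed⊆G : (G −ᴱ skeleton) ⊆ᴱ G
  removed⊆G i j (i<j , removed) = i<j , proj₁ (∧-≡-true removed)

  kept≡ : ∀ i j → H i j ≡ G i j ∧ skeleton i j
  kept≡ i j with G i j
  ... | true  = Bool.not-involutive (skeleton i j)
  ... | false = refl

  kept : ∀ i j → (i , j) ∈ᴱ H → Skeleton i j
  kept i j (_ , e) =
    does-true (skeleton? i j) (proj₂ (∧-≡-true {G i j} (trans (sym (kept≡ i j)) e)))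

  keep : ∀ i j → (i , j) ∈ᴱ G → Skeleton i j → (i , j) ∈ᴱ H
  keep i j (i<j , g) s = i<j , trans (kept≡ i j) (cong₂ _∧_ g (dec-true (skeleton? i j) s))

  plane : Plane H
  plane a b c d ab cd with kept a b ab | kept c d cd
  ... | inj₁ boundary-ab | _              = boundary-uncrossed a b c d boundary-ab
  ... | inj₂ _           | inj₁ boundary-cd = boundary-uncrossed c d a b boundary-cd ∘ Cross-sym
  ... | inj₂ D-ab        | inj₂ D-cd      = D-plane a b c d (proj₁ ab , D-ab) (proj₁ cd , D-cd)

  large : 2 * (2 + k) ≤ ∣ H ∣ᴱ + 1
  large = begin
    2 * (2 + k)                   ≡⟨ two-n-minus-three k ⟩
    (3 + k) + k + 1               ≤⟨ +-monoˡ-≤ 1 (+-mono-≤ (boundary-count k) (≤-reflexive (sym ∣D∣≡k))) ⟩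
    #boundary + ∣ D ∣ᴱ + 1        ≡⟨ cong (λ x → #boundary + x + 1) (∣∣ᴱ≡count D) ⟩
    #boundary + count (∈ᴱ? D) + 1 ≤⟨ +-monoˡ-≤ 1 (count-disjoint boundary-edge? (∈ᴱ? D) (∈ᴱ? H)
                                        boundary-kept D-kept (λ i j (_ , b) d → diagonal i j d b)) ⟩
    count (∈ᴱ? H) + 1             ≡⟨ cong (_+ 1) (sym (∣∣ᴱ≡count H)) ⟩
    ∣ H ∣ᴱ + 1                    ∎
    where
    open ≤-Reasoning
    #boundary = count (boundary-edge? {3 + k})
    two-n-minus-three : ∀ k → 2 * (2 + k) ≡ (3 + k) + k + 1
    two-n-minus-three = solve-∀
    boundary-kept : ∀ i j → i <ᶠ j × Boundary i j → (i , j) ∈ᴱ H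
    boundary-kept i j (i<j , b) = keep i j (boundary⊆G i j i<j b) (inj₁ b)
    D-kept : ∀ i j → (i , j) ∈ᴱ D → (i , j) ∈ᴱ H
    D-kept i j (i<j , d) = keep i j (D⊆G i j (i<j , d)) (inj₂ d)

skewness-of-maximal-plane : ∀ {n} (G R₀ : EdgeSet n) → 2 ≤ n → R₀ ⊆ᴱ G → Plane (G −ᴱ R₀) →
  2 * pred n ≤ ∣ G −ᴱ R₀ ∣ᴱ + 1 →
  IsConvexSkewness G ∣ R₀ ∣ᴱ × (∣ R₀ ∣ᴱ + 2 * pred n ≡ ∣ G ∣ᴱ + 1)
skewness-of-maximal-plane {n} G R₀ 2≤n R₀⊆G plane₀ large =
  ((R₀ , R₀⊆G , plane₀ , refl) , minimal) , size
  where
  W = 2 * pred n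
  shuffle : ∀ r h → r + (h + 1) ≡ (h + r) + 1
  shuffle = solve-∀
  size : ∣ R₀ ∣ᴱ + W ≡ ∣ G ∣ᴱ + 1
  size = begin
    ∣ R₀ ∣ᴱ + W                     ≡⟨ cong (∣ R₀ ∣ᴱ +_) (≤-antisym large (plane-bound (G −ᴱ R₀) plane₀ 2≤n)) ⟩
    ∣ R₀ ∣ᴱ + (∣ G −ᴱ R₀ ∣ᴱ + 1)    ≡⟨ shuffle ∣ R₀ ∣ᴱ _ ⟩
    (∣ G −ᴱ R₀ ∣ᴱ + ∣ R₀ ∣ᴱ) + 1    ≡⟨ cong (_+ 1) (removal-size G R₀ R₀⊆G) ⟩
    ∣ G ∣ᴱ + 1                      ∎
    where open ≡-Reasoning
  -- any other deletion set R leaves a plane graph of at most 2n − 3 edges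
  minimal : ∀ R → R ⊆ᴱ G → Plane (G −ᴱ R) → ∣ R₀ ∣ᴱ ≤ ∣ R ∣ᴱ
  minimal R R⊆G plane = +-cancelʳ-≤ W ∣ R₀ ∣ᴱ ∣ R ∣ᴱ (begin
    ∣ R₀ ∣ᴱ + W                     ≡⟨ size ⟩
    ∣ G ∣ᴱ + 1                      ≡⟨ cong (_+ 1) (sym (removal-size G R R⊆G)) ⟩
    (∣ G −ᴱ R ∣ᴱ + ∣ R ∣ᴱ) + 1      ≡⟨ sym (shuffle ∣ R ∣ᴱ _) ⟩
    ∣ R ∣ᴱ + (∣ G −ᴱ R ∣ᴱ + 1)      ≤⟨ +-monoʳ-≤ ∣ R ∣ᴱ (plane-bound (G −ᴱ R) plane 2≤n) ⟩
    ∣ R ∣ᴱ + W                      ∎)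
    where open ≤-Reasoning

-- n C 2 = (n − 2) C 2 + (2n − 3), written for n = 3 + k
binomial-split : ∀ k → (3 + k) C 2 + 1 ≡ (1 + k) C 2 + 2 * (2 + k)
binomial-split k = begin
  (3 + k) C 2 + 1                         ≡⟨ cong (_+ 1) (trans (C2-suc (2 + k))
                                                                (cong ((2 + k) +_) (C2-suc (1 + k)))) ⟩
  (2 + k) + ((1 + k) + (1 + k) C 2) + 1   ≡⟨ rearrange k ((1 + k) C 2) ⟩
  (1 + k) C 2 + 2 * (2 + k)               ∎
  where
  open ≡-Reasoning
  rearrange : ∀ k c → (2 + k) + ((1 + k) + c) + 1 ≡ c + 2 * (2 + k)
  rearrange = solve-∀

deleted+F : ∀ k (F R₀ : EdgeSet (3 + k)) → ∣ R₀ ∣ᴱ + 2 * (2 + k) ≡ ∣ K-minus F ∣ᴱ + 1 →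
            ∣ R₀ ∣ᴱ + ∣ F ∣ᴱ ≡ (1 + k) C 2
deleted+F k F R₀ size = +-cancelʳ-≡ (2 * (2 + k)) _ _ (begin
  (∣ R₀ ∣ᴱ + ∣ F ∣ᴱ) + 2 * (2 + k)    ≡⟨ swap ∣ R₀ ∣ᴱ ∣ F ∣ᴱ _ ⟩
  (∣ R₀ ∣ᴱ + 2 * (2 + k)) + ∣ F ∣ᴱ    ≡⟨ cong (_+ ∣ F ∣ᴱ) size ⟩
  (∣ K-minus F ∣ᴱ + 1) + ∣ F ∣ᴱ       ≡⟨ swap ∣ K-minus F ∣ᴱ 1 ∣ F ∣ᴱ ⟩
  (∣ K-minus F ∣ᴱ + ∣ F ∣ᴱ) + 1       ≡⟨ cong (_+ 1) (complement-size F) ⟩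
  (3 + k) C 2 + 1                     ≡⟨ binomial-split k ⟩
  (1 + k) C 2 + 2 * (2 + k)           ∎)
  where
  open ≡-Reasoning
  swap : ∀ x y z → (x + y) + z ≡ (x + z) + y
  swap = solve-∀

proposition4 : (n : ℕ) → 3 ≤ n → (F : EdgeSet n) →
    AdmitsTriangulation (K-minus F) →
    IsConvexSkewness (K-minus F) ((n ∸ 2) C 2 ∸ ∣ F ∣ᴱ) × (∣ F ∣ᴱ ≤ (n ∸ 2) C 2)
proposition4 zero                ()
proposition4 (suc zero)          (s≤s ())
proposition4 (suc (suc zero))    (s≤s (s≤s ()))
proposition4 (suc (suc (suc k))) _ F triangulated =
  let R₀ , R₀⊆G , plane , large = triangulation-skeleton k (K-minus F) triangulated
      skewness , size = skewness-of-maximal-plane (K-minus F) R₀ (s≤s (s≤s z≤n)) R₀⊆G plane large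
      R₀+F = deleted+F k F R₀ size
      ∣R₀∣≡ = trans (sym (m+n∸n≡m ∣ R₀ ∣ᴱ ∣ F ∣ᴱ)) (cong (_∸ ∣ F ∣ᴱ) R₀+F)
  in subst (IsConvexSkewness (K-minus F)) ∣R₀∣≡ skewness , subst (∣ F ∣ᴱ ≤_) R₀+F (m≤n+m ∣ F ∣ᴱ ∣ R₀ ∣ᴱ)
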